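{- Let $p$ be a prime number and $k \geq 1$ an integer. Let $M=(m_{ij})_{0\le i,j<p^k}$ be a difference matrix in $D(p^k,p^k,\mathbb{Z}_p^k)$, and let $(a(n))_{n\ge 0}$ be the Rudin--Shapiro sequence associated to $M$ (with $a(0)\in\mathbb{Z}_p^k$ arbitrary). For $0\le i<j$ let $\delta(i,j)=0$ if $a(i)=a(j)$ and $\delta(i,j)=1$ otherwise. Then, for $0 \leq r_1 < r_2$, as $N \to \infty$, $$\sum_{n<N}\delta(n+r_1,n+r_2)=N\left(1-\frac{1}{p^k}\right)+O_{p,k}\left((r_2-r_1)\log\frac{N}{r_2-r_1}+r_2\right),$$ where the implied constant depends only on $p$ and $k$ (and not on $r_1,r_2$, which are allowed to depend on $N$).
   Context: $\mathbb{Z}_p=\mathbb{Z}/p\mathbb{Z}$ and $\mathbb{Z}_p^k$ is the $k$-fold product group. For a finite abelian group $G$, a difference matrix $D=(d_{ij})$ of size $r\times c$ with entries in $G$ is a matrix such that for all $i\neq j$ in $\{1,\dots,c\}$, the multiset $\{d_{li}-d_{lj}:1\le l\le r\}$ contains every element of $G$ equally often; $D(r,c,G)$ denotes the set of such matrices. Given $M=(m_{ij})_{0\le i,j<p^k}\in D(p^k,p^k,\mathbb{Z}_p^k)$, define $g:\mathbb{Z}\times\mathbb{Z}\to\mathbb{Z}_p^k$ by $g(j,n)=m_{n \bmod p^k,\, j \bmod p^k}$. The Rudin--Shapiro sequence associated to $M$ is the sequence $(a(n))_{n\ge0}$ with values in $\mathbb{Z}_p^k$, with $a(0)$ fixed arbitrarily,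 defined by $a(p^kn+j)=a(n)+g(j,n)$ for $0\le j\le p^k-1$, $n\ge 0$, $(j,n)\neq(0,0)$. -}

module Defs where

open import Data.Nat using (ℕ; zero; suc; _+_; _*_; _∸_; _^_; _<_; NonZero)
open import Data.Nat.Properties using (m^n≢0)
open import Data.Nat.DivMod using (_mod_; _/_)
open import Data.Nat.Logarithm using (⌊log₂_⌋)
open import Data.Fin using (Fin; toℕ) renaming (_≟_ to _≟ᶠ_)
open import Data.Vec using (Vec; zipWith; replicate)
open import Data.Vec.Properties using (≡-dec)
open import Data.List using (List; length; filter)
open import Data.List using () renaming (allFin to allFinL)
open import Data.Product using (_×_)
open import Relation.Binary.PropositionalEquality using (_≡_; _≢_)
open import Relation.Nullary using (¬_; yes; no)
open import Relation.Binary.Definitions using (DecidableEquality)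

G : (p k : ℕ) → Set
G p k = Vec (Fin p) k

module _ {p : ℕ} .{{_ : NonZero p}} where
  _+ₚ_ : Fin p → Fin p → Fin p
  x +ₚ y = (toℕ x + toℕ y) mod p

  _-ₚ_ : Fin p → Fin p → Fin p
  x -ₚ y = (toℕ x + (p ∸ toℕ y)) mod p

  _⊕_ : {k : ℕ} → G p k → G p k → G p k
  _⊕_ = zipWith _+ₚ_

  _⊖_ : {k : ℕ} → G p k → G p k → G p k
  _⊖_ = zipWith _-ₚ_

_≟G_ : {p k : ℕ} → DecidableEquality (G p k)
_≟G_ = ≡-dec _≟ᶠ_

countDiff : {p k r c : ℕ} .{{_ : NonZero p}} →
            (Fin r → Fin c → G p k) → Fin c → Fin c → G p k → ℕ
countDiff {r = r} D i j g =
  length (filter (λ l → (D l i ⊖ D l j) ≟G g) (allFinL r))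

IsDifferenceMatrix : {p k r c : ℕ} .{{_ : NonZero p}} →
                     (Fin r → Fin c → G p k) → Set
IsDifferenceMatrix {p} {k} {r} {c} D =
  (i j : Fin c) → i ≢ j → (g h : G p k) → countDiff D i j g ≡ countDiff D i j h

gM : (p k : ℕ) .{{_ : NonZero p}} →
     (Fin (p ^ k) → Fin (p ^ k) → G p k) → ℕ → ℕ → G p k
gM p k M j n = M (_mod_ n (p ^ k) {{m^n≢0 p k}}) (_mod_ j (p ^ k) {{m^n≢0 p k}})

-- a is the Rudin–Shapiro sequence associated to M (a(0) arbitrary)
IsRudinShapiro : (p k : ℕ) .{{_ : NonZero p}} →
                 (Fin (p ^ k) → Fin (p ^ k) → G p k) → (ℕ → G p k) → Set
IsRudinShapiro p k M a =
  (n j : ℕ) → j < p ^ k → ¬ (j ≡ 0 × n ≡ 0) →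
  a (p ^ k * n + j) ≡ (a n ⊕ gM p k M j n)

δ : {p k : ℕ} → (ℕ → G p k) → ℕ → ℕ → ℕ
δ a i j with a i ≟G a j
... | yes _ = 0
... | no _  = 1

Sδ : {p k : ℕ} → (ℕ → G p k) → ℕ → ℕ → ℕ → ℕ
Sδ a r₁ r₂ zero    = 0
Sδ a r₁ r₂ (suc N) = Sδ a r₁ r₂ N + δ a (N + r₁) (N + r₂)

errTerm : (N r₁ r₂ : ℕ) → r₁ < r₂ → ℕ
errTerm N r₁ r₂ _ with r₂ ∸ r₁
... | zero  = r₂
... | suc d = suc d * (1 + ⌊log₂ (N / suc d) ⌋) + r₂

-- Put q = p ^ k and d = r₂ − r₁.  Each x separates from x + d at exactly one level t: the two lie in
-- the same block of length q ^ (t + 1) but in different blocks of length q ^ t.  Unfolding the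
-- recursion, a x and a (x + d) then agree iff M r u′ ⊖ M r u equals a quantity not depending on the
-- block, where r is the index of the common block mod q and u ≠ u′ are the t-th base-q digits of x
-- and x + d.  Along q consecutive blocks (past the first one) r runs through all rows of M, and the
-- difference-matrix property leaves exactly one agreement.  Hence at every level a proportion
-- (q − 1) / q of the separated pairs disagree, up to O (q³ min (q ^ t, d)) from two incomplete
-- periods.  Only levels with q ^ t < r₂ + N contribute, and summing min (q ^ t, d) over them gives
-- O (d log (N / d) + r₂).

module Submission where

open import Defs
open import Data.Nat using (ℕ; _*_; _∸_; _^_; _≤_; _<_; NonZero)
open import Data.Nat.Primality using (Prime)
open import Data.Fin using (Fin)
open import Data.Integer using (+_; _-_; ∣_∣)
open import Data.Product using (∃-syntax)

open import Data.Nat using (zero; suc; _+_; _⊓_; _⊔_; z≤n; s≤s; _≟_; _≤?_; _<?_; >-nonZero; nonTrivial⇒n>1)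
open import Data.Nat.DivMod
open import Data.Nat.Divisibility using (n∣m*n)
open import Data.Nat.Logarithm using (⌊log₂_⌋; ⌊log₂⌋-mono-≤; ⌊log₂[2^n]⌋≡n)
open import Data.Nat.Primality using (prime⇒nonTrivial)
open import Data.Nat.Properties
open import Data.Nat.Tactic.RingSolver using (solve-∀)
open import Algebra.Properties.CommutativeMonoid.Sum +-0-commutativeMonoid using (sum-syntax; sum-cong-≗; ∑-comm)
open import Algebra.Properties.CommutativeSemigroup +-commutativeSemigroup using (interchange; xy∙z≈xz∙y)
open import Data.Empty using (⊥-elim)
open import Data.Fin using (toℕ; zero; suc) renaming (_≟_ to _≟ᶠ_)
open import Data.Fin.Properties using (toℕ-fromℕ<; toℕ-injective; toℕ<n) renaming (suc-injective to Fin-suc-injective)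
import Data.Integer.Properties as ℤ
open import Data.List using (length; filter; tabulate)
open import Data.Product using (_×_; _,_; proj₁; proj₂; Σ-syntax)
open import Data.Sum using (_⊎_; inj₁; inj₂)
open import Data.Vec using ([]; _∷_; replicate)
open import Data.Vec.Properties using (zipWith-assoc; zipWith-comm; zipWith-identityʳ; ∷-injectiveˡ; ∷-injectiveʳ)
open import Function using (_∘_; id; _⇔_; mk⇔; Equivalence)
open import Function.Properties.Equivalence using (⇔-setoid)
open import Level using (0ℓ)
open import Relation.Binary.PropositionalEquality
import Relation.Binary.Reasoning.Setoid as ⇔-Reasoning
open import Relation.Nullary using (Dec; yes; no; ¬_; contradiction)
open import Relation.Unary using (Pred; Decidable)

sumTo : ℕ → (ℕ → ℕ) → ℕ
sumTo zero    f = 0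
sumTo (suc n) f = sumTo n f + f n

module _ {f g : ℕ → ℕ} where

  sumTo-cong : ∀ n → (∀ i → i < n → f i ≡ g i) → sumTo n f ≡ sumTo n g
  sumTo-cong zero    f≡g = refl
  sumTo-cong (suc n) f≡g = cong₂ _+_ (sumTo-cong n (λ i i<n → f≡g i (m<n⇒m<1+n i<n))) (f≡g n ≤-refl)

  sumTo-mono-≤ : ∀ n → (∀ i → i < n → f i ≤ g i) → sumTo n f ≤ sumTo n g
  sumTo-mono-≤ zero    f≤g = z≤n
  sumTo-mono-≤ (suc n) f≤g = +-mono-≤ (sumTo-mono-≤ n (λ i i<n → f≤g i (m<n⇒m<1+n i<n))) (f≤g n ≤-refl)

  sumTo-distrib-+ : ∀ n → sumTo n (λ i → f i + g i) ≡ sumTo n f + sumTo n g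
  sumTo-distrib-+ zero    = refl
  sumTo-distrib-+ (suc n) rewrite sumTo-distrib-+ n = interchange (sumTo n f) (sumTo n g) (f n) (g n)

sumTo-const : ∀ n c → sumTo n (λ _ → c) ≡ n * c
sumTo-const zero    c = refl
sumTo-const (suc n) c rewrite sumTo-const n c = +-comm (n * c) c

sumTo-zero : ∀ n → sumTo n (λ _ → 0) ≡ 0
sumTo-zero n = trans (sumTo-const n 0) (*-zeroʳ n)

sumTo-*ˡ : ∀ n c (f : ℕ → ℕ) → sumTo n (λ i → c * f i) ≡ c * sumTo n f
sumTo-*ˡ zero    c f = sym (*-zeroʳ c)
sumTo-*ˡ (suc n) c f rewrite sumTo-*ˡ n c f = sym (*-distribˡ-+ c (sumTo n f) (f n))

sumTo-split : ∀ m n (f : ℕ → ℕ) → sumTo (m + n) f ≡ sumTo m f + sumTo n (λ i → f (m + i))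
sumTo-split m zero    f rewrite +-identityʳ m = sym (+-identityʳ _)
sumTo-split m (suc n) f rewrite +-suc m n | sumTo-split m n f = +-assoc (sumTo m f) _ _

sumTo-shift : ∀ n m (f : ℕ → ℕ) → sumTo n (λ i → f (i + m)) + sumTo m f ≡ sumTo n f + sumTo m (λ i → f (n + i))
sumTo-shift n m f = begin
  sumTo n (λ i → f (i + m)) + sumTo m f   ≡⟨ +-comm _ (sumTo m f) ⟩
  sumTo m f + sumTo n (λ i → f (i + m))   ≡⟨ cong (_+_ (sumTo m f)) (sumTo-cong n (λ i _ → cong f (+-comm i m))) ⟩
  sumTo m f + sumTo n (λ i → f (m + i))   ≡⟨ sumTo-split m n f ⟨
  sumTo (m + n) f                         ≡⟨ cong (λ l → sumTo l f) (+-comm m n) ⟩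
  sumTo (n + m) f                         ≡⟨ sumTo-split n m f ⟩
  sumTo n f + sumTo m (λ i → f (n + i))   ∎
  where open ≡-Reasoning

sumTo-prefix-≤ : ∀ {m n} (f : ℕ → ℕ) → m ≤ n → sumTo m f ≤ sumTo n f
sumTo-prefix-≤ {m} {n} f m≤n = begin
  sumTo m f                                     ≤⟨ m≤m+n _ _ ⟩
  sumTo m f + sumTo (n ∸ m) (λ i → f (m + i))   ≡⟨ sumTo-split m (n ∸ m) f ⟨
  sumTo (m + (n ∸ m)) f                         ≡⟨ cong (λ l → sumTo l f) (m+[n∸m]≡n m≤n) ⟩
  sumTo n f                                     ∎
  where open ≤-Reasoning

sumTo-blocks : ∀ a b (f : ℕ → ℕ) → sumTo (a * b) f ≡ sumTo a (λ i → sumTo b (λ j → f (b * i + j)))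
sumTo-blocks zero    b f = refl
sumTo-blocks (suc a) b f = begin
  sumTo (b + a * b) f                                               ≡⟨ cong (λ l → sumTo l f) (+-comm b (a * b)) ⟩
  sumTo (a * b + b) f                                               ≡⟨ sumTo-split (a * b) b f ⟩
  sumTo (a * b) f + sumTo b (λ j → f (a * b + j))
    ≡⟨ cong₂ _+_ (sumTo-blocks a b f) (sumTo-cong b (λ j _ → cong (λ c → f (c + j)) (*-comm a b))) ⟩
  sumTo a (λ i → sumTo b (λ j → f (b * i + j))) + sumTo b (λ j → f (b * a + j)) ∎
  where open ≡-Reasoning

sumTo-swap : ∀ a b (f : ℕ → ℕ → ℕ) →
             sumTo a (λ i → sumTo b (f i)) ≡ sumTo b (λ j → sumTo a (λ i → f i j))
sumTo-swap zero    b f = sym (sumTo-zero b)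
sumTo-swap (suc a) b f rewrite sumTo-swap a b f = sym (sumTo-distrib-+ b)

-- Approximate equality

infix 4 _≈[_]_

_≈[_]_ : ℕ → ℕ → ℕ → Set
A ≈[ e ] B = A ≤ B + e × B ≤ A + e

≈-reflexive : ∀ {A B} e → A ≡ B → A ≈[ e ] B
≈-reflexive {A} e refl = m≤m+n A e , m≤m+n A e

≈-bounded : ∀ {A B e} → A ≤ e → B ≤ e → A ≈[ e ] B
≈-bounded {A} {B} {e} A≤e B≤e = ≤-trans A≤e (m≤n+m e B) , ≤-trans B≤e (m≤n+m e A)

≈-mono : ∀ {A B e e′} → e ≤ e′ → A ≈[ e ] B → A ≈[ e′ ] B
≈-mono {A} {B} e≤e′ (A≤ , B≤) = ≤-trans A≤ (+-monoʳ-≤ B e≤e′) , ≤-trans B≤ (+-monoʳ-≤ A e≤e′)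

≈-+ : ∀ {A B C D e f} → A ≈[ e ] B → C ≈[ f ] D → A + C ≈[ e + f ] B + D
≈-+ {A} {B} {C} {D} {e} {f} (A≤ , B≤) (C≤ , D≤) =
  ≤-trans (+-mono-≤ A≤ C≤) (≤-reflexive (interchange B e D f)) ,
  ≤-trans (+-mono-≤ B≤ D≤) (≤-reflexive (interchange A e C f))

≈-cancelˡ : ∀ {A B C D e f} → A ≈[ e ] B → A + C ≈[ f ] B + D → C ≈[ e + f ] D
≈-cancelˡ {A} {B} {C} {D} {e} {f} (A≤ , B≤) (AC≤ , BD≤) =
  +-cancelˡ-≤ A _ _ (begin
    A + C           ≤⟨ AC≤ ⟩
    B + D + f       ≤⟨ +-monoˡ-≤ f (+-monoˡ-≤ D B≤) ⟩
    A + e + D + f   ≡⟨ regroup A e D f ⟩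
    A + (D + (e + f)) ∎) ,
  +-cancelˡ-≤ B _ _ (begin
    B + D           ≤⟨ BD≤ ⟩
    A + C + f       ≤⟨ +-monoˡ-≤ f (+-monoˡ-≤ C A≤) ⟩
    B + e + C + f   ≡⟨ regroup B e C f ⟩
    B + (C + (e + f)) ∎)
  where
  open ≤-Reasoning
  regroup : ∀ w x y z → w + x + y + z ≡ w + (y + (x + z))
  regroup = solve-∀

≈-sumTo : ∀ n {A B e : ℕ → ℕ} → (∀ i → i < n → A i ≈[ e i ] B i) →
          sumTo n A ≈[ sumTo n e ] sumTo n B
≈-sumTo zero    A≈B = z≤n , z≤n
≈-sumTo (suc n) A≈B = ≈-+ (≈-sumTo n (λ i i<n → A≈B i (m<n⇒m<1+n i<n))) (A≈B n ≤-refl)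

≈⇒∣-∣≤ : ∀ {A B e} → A ≈[ e ] B → ∣ + A - + B ∣ ≤ e
≈⇒∣-∣≤ {A} {B} {e} (A≤B+e , B≤A+e) rewrite ℤ.[+m]-[+n]≡m⊖n A B with ≤-total A B
... | inj₁ A≤B = ≤-trans (≤-reflexive (ℤ.∣⊖∣-≤ A≤B)) (m≤n+o⇒m∸n≤o B A B≤A+e)
... | inj₂ B≤A = ≤-trans (≤-reflexive (trans (ℤ.∣m⊖n∣≡∣n⊖m∣ A B) (ℤ.∣⊖∣-≤ B≤A))) (m≤n+o⇒m∸n≤o A B A≤B+e)

module _ {p : ℕ} .{{_ : NonZero p}} where

  private
    [m%p+n]%p≡[m+n]%p : ∀ m n → (m % p + n) % p ≡ (m + n) % p
    [m%p+n]%p≡[m+n]%p m n = begin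
      (m % p + n) % p           ≡⟨ %-distribˡ-+ (m % p) n p ⟩
      (m % p % p + n % p) % p   ≡⟨ cong (λ r → (r + n % p) % p) (m%n%n≡m%n m p) ⟩
      (m % p + n % p) % p       ≡⟨ %-distribˡ-+ m n p ⟨
      (m + n) % p               ∎
      where open ≡-Reasoning

    [m+n%p]%p≡[m+n]%p : ∀ m n → (m + n % p) % p ≡ (m + n) % p
    [m+n%p]%p≡[m+n]%p m n = begin
      (m + n % p) % p   ≡⟨ cong (_% p) (+-comm m (n % p)) ⟩
      (n % p + m) % p   ≡⟨ [m%p+n]%p≡[m+n]%p n m ⟩
      (n + m) % p       ≡⟨ cong (_% p) (+-comm n m) ⟩
      (m + n) % p       ∎
      where open ≡-Reasoning

    toℕ-+ₚ : ∀ (x y : Fin p) → toℕ (x +ₚ y) ≡ (toℕ x + toℕ y) % p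
    toℕ-+ₚ x y = toℕ-fromℕ< _

    toℕ--ₚ : ∀ (x y : Fin p) → toℕ (x -ₚ y) ≡ (toℕ x + (p ∸ toℕ y)) % p
    toℕ--ₚ x y = toℕ-fromℕ< _

    [x+p]%p≡x : ∀ (x : Fin p) → (toℕ x + p) % p ≡ toℕ x
    [x+p]%p≡x x = trans ([m+n]%n≡m%n (toℕ x) p) (m<n⇒m%n≡m (toℕ<n x))

    y+[p∸y]≡p : ∀ (y : Fin p) → toℕ y + (p ∸ toℕ y) ≡ p
    y+[p∸y]≡p y = m+[n∸m]≡n (<⇒≤ (toℕ<n y))

  +ₚ-comm : ∀ (x y : Fin p) → x +ₚ y ≡ y +ₚ x
  +ₚ-comm x y = toℕ-injective (begin
    toℕ (x +ₚ y)            ≡⟨ toℕ-+ₚ x y ⟩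
    (toℕ x + toℕ y) % p     ≡⟨ cong (_% p) (+-comm (toℕ x) (toℕ y)) ⟩
    (toℕ y + toℕ x) % p     ≡⟨ toℕ-+ₚ y x ⟨
    toℕ (y +ₚ x)            ∎)
    where open ≡-Reasoning

  +ₚ-assoc : ∀ (x y z : Fin p) → (x +ₚ y) +ₚ z ≡ x +ₚ (y +ₚ z)
  +ₚ-assoc x y z = toℕ-injective (begin
    toℕ ((x +ₚ y) +ₚ z)                  ≡⟨ toℕ-+ₚ (x +ₚ y) z ⟩
    (toℕ (x +ₚ y) + toℕ z) % p           ≡⟨ cong (λ r → (r + toℕ z) % p) (toℕ-+ₚ x y) ⟩
    ((toℕ x + toℕ y) % p + toℕ z) % p    ≡⟨ [m%p+n]%p≡[m+n]%p _ _ ⟩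
    (toℕ x + toℕ y + toℕ z) % p          ≡⟨ cong (_% p) (+-assoc (toℕ x) _ _) ⟩
    (toℕ x + (toℕ y + toℕ z)) % p        ≡⟨ [m+n%p]%p≡[m+n]%p _ _ ⟨
    (toℕ x + (toℕ y + toℕ z) % p) % p    ≡⟨ cong (λ r → (toℕ x + r) % p) (toℕ-+ₚ y z) ⟨
    (toℕ x + toℕ (y +ₚ z)) % p           ≡⟨ toℕ-+ₚ x (y +ₚ z) ⟨
    toℕ (x +ₚ (y +ₚ z))                  ∎)
    where open ≡-Reasoning

  +ₚ-identityʳ : ∀ (x : Fin p) → x +ₚ (0 mod p) ≡ x
  +ₚ-identityʳ x = toℕ-injective (begin
    toℕ (x +ₚ (0 mod p))          ≡⟨ toℕ-+ₚ x (0 mod p) ⟩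
    (toℕ x + toℕ (0 mod p)) % p   ≡⟨ cong (λ r → (toℕ x + r) % p) (toℕ-fromℕ< _) ⟩
    (toℕ x + 0 % p) % p           ≡⟨ [m+n%p]%p≡[m+n]%p (toℕ x) 0 ⟩
    (toℕ x + 0) % p               ≡⟨ cong (_% p) (+-identityʳ (toℕ x)) ⟩
    toℕ x % p                     ≡⟨ m<n⇒m%n≡m (toℕ<n x) ⟩
    toℕ x                         ∎)
    where open ≡-Reasoning

  +ₚ--ₚ-comm : ∀ (x y z : Fin p) → (x +ₚ y) -ₚ z ≡ (x -ₚ z) +ₚ y
  +ₚ--ₚ-comm x y z = toℕ-injective (begin
    toℕ ((x +ₚ y) -ₚ z)                          ≡⟨ toℕ--ₚ (x +ₚ y) z ⟩
    (toℕ (x +ₚ y) + (p ∸ toℕ z)) % p             ≡⟨ cong (λ r → (r + (p ∸ toℕ z)) % p) (toℕ-+ₚ x y) ⟩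
    ((toℕ x + toℕ y) % p + (p ∸ toℕ z)) % p      ≡⟨ [m%p+n]%p≡[m+n]%p _ _ ⟩
    (toℕ x + toℕ y + (p ∸ toℕ z)) % p            ≡⟨ cong (_% p) (xy∙z≈xz∙y (toℕ x) _ _) ⟩
    (toℕ x + (p ∸ toℕ z) + toℕ y) % p            ≡⟨ [m%p+n]%p≡[m+n]%p _ _ ⟨
    ((toℕ x + (p ∸ toℕ z)) % p + toℕ y) % p      ≡⟨ cong (λ r → (r + toℕ y) % p) (toℕ--ₚ x z) ⟨
    (toℕ (x -ₚ z) + toℕ y) % p                   ≡⟨ toℕ-+ₚ (x -ₚ z) y ⟨
    toℕ ((x -ₚ z) +ₚ y)                          ∎)
    where open ≡-Reasoning

  -ₚ-+ₚ-cancel : ∀ (x y : Fin p) → (x -ₚ y) +ₚ y ≡ x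
  -ₚ-+ₚ-cancel x y = toℕ-injective (begin
    toℕ ((x -ₚ y) +ₚ y)                          ≡⟨ toℕ-+ₚ (x -ₚ y) y ⟩
    (toℕ (x -ₚ y) + toℕ y) % p                   ≡⟨ cong (λ r → (r + toℕ y) % p) (toℕ--ₚ x y) ⟩
    ((toℕ x + (p ∸ toℕ y)) % p + toℕ y) % p      ≡⟨ [m%p+n]%p≡[m+n]%p _ _ ⟩
    (toℕ x + (p ∸ toℕ y) + toℕ y) % p            ≡⟨ cong (_% p) (+-assoc (toℕ x) _ _) ⟩
    (toℕ x + ((p ∸ toℕ y) + toℕ y)) % p          ≡⟨ cong (λ r → (toℕ x + r) % p) (trans (+-comm (p ∸ toℕ y) _) (y+[p∸y]≡p y)) ⟩
    (toℕ x + p) % p                              ≡⟨ [x+p]%p≡x x ⟩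
    toℕ x                                        ∎)
    where open ≡-Reasoning

  0̄ : ∀ {k} → G p k
  0̄ {k} = replicate k (0 mod p)

  ⊕-assoc : ∀ {k} (x y z : G p k) → (x ⊕ y) ⊕ z ≡ x ⊕ (y ⊕ z)
  ⊕-assoc = zipWith-assoc +ₚ-assoc

  ⊕-comm : ∀ {k} (x y : G p k) → x ⊕ y ≡ y ⊕ x
  ⊕-comm = zipWith-comm +ₚ-comm

  ⊕-identityʳ : ∀ {k} (x : G p k) → x ⊕ 0̄ ≡ x
  ⊕-identityʳ = zipWith-identityʳ +ₚ-identityʳ

  ⊕-⊖-comm : ∀ {k} (x y z : G p k) → (x ⊕ y) ⊖ z ≡ (x ⊖ z) ⊕ y
  ⊕-⊖-comm []       []       []       = refl
  ⊕-⊖-comm (x ∷ xs) (y ∷ ys) (z ∷ zs) = cong₂ _∷_ (+ₚ--ₚ-comm x y z) (⊕-⊖-comm xs ys zs)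

  ⊖-⊕-cancel : ∀ {k} (x y : G p k) → (x ⊖ y) ⊕ y ≡ x
  ⊖-⊕-cancel []       []       = refl
  ⊖-⊕-cancel (x ∷ xs) (y ∷ ys) = cong₂ _∷_ (-ₚ-+ₚ-cancel x y) (⊖-⊕-cancel xs ys)

  ⊕-⊖-cancel : ∀ {k} (x y : G p k) → (x ⊕ y) ⊖ y ≡ x
  ⊕-⊖-cancel x y = trans (⊕-⊖-comm x y y) (⊖-⊕-cancel x y)

  module _ {k : ℕ} where

    ⊕≡⇔≡⊖ : ∀ {x y z : G p k} → (x ⊕ y ≡ z) ⇔ (x ≡ z ⊖ y)
    ⊕≡⇔≡⊖ {x} {y} {z} = mk⇔ (λ x⊕y≡z → trans (sym (⊕-⊖-cancel x y)) (cong (_⊖ y) x⊕y≡z))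
                              (λ x≡z⊖y → trans (cong (_⊕ y) x≡z⊖y) (⊖-⊕-cancel z y))

    ⊕-cancelˡ-⇔ : ∀ a {x y : G p k} → (a ⊕ x ≡ a ⊕ y) ⇔ (x ≡ y)
    ⊕-cancelˡ-⇔ a {x} {y} = mk⇔ cancel (cong (a ⊕_))
      where
      cancel : a ⊕ x ≡ a ⊕ y → x ≡ y
      cancel eq = begin
        x             ≡⟨ ⊕-⊖-cancel x a ⟨
        (x ⊕ a) ⊖ a   ≡⟨ cong (_⊖ a) (trans (⊕-comm x a) (trans eq (⊕-comm a y))) ⟩
        (y ⊕ a) ⊖ a   ≡⟨ ⊕-⊖-cancel y a ⟩
        y             ∎
        where open ≡-Reasoning

    ⊕⊕≡⊕⊕⇔⊖≡⊖ : ∀ (a b c d e : G p k) → ((a ⊕ b) ⊕ c ≡ (a ⊕ d) ⊕ e) ⇔ (d ⊖ b ≡ c ⊖ e)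
    ⊕⊕≡⊕⊕⇔⊖≡⊖ a b c d e = begin
      ((a ⊕ b) ⊕ c ≡ (a ⊕ d) ⊕ e)   ≡⟨ cong₂ _≡_ (⊕-assoc a b c) (⊕-assoc a d e) ⟩
      (a ⊕ (b ⊕ c) ≡ a ⊕ (d ⊕ e))   ≈⟨ ⊕-cancelˡ-⇔ a ⟩
      (b ⊕ c ≡ d ⊕ e)               ≡⟨ cong (_≡ d ⊕ e) (⊕-comm b c) ⟩
      (c ⊕ b ≡ d ⊕ e)               ≈⟨ ⊕≡⇔≡⊖ ⟩
      (c ≡ (d ⊕ e) ⊖ b)             ≡⟨ cong (c ≡_) (⊕-⊖-comm d e b) ⟩
      (c ≡ (d ⊖ b) ⊕ e)             ≈⟨ mk⇔ sym sym ⟩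
      ((d ⊖ b) ⊕ e ≡ c)             ≈⟨ ⊕≡⇔≡⊖ ⟩
      (d ⊖ b ≡ c ⊖ e)               ∎
      where open ⇔-Reasoning (⇔-setoid 0ℓ)

-- Counting and difference matrices

𝟙 : ∀ {a} {A : Set a} → Dec A → ℕ
𝟙 (yes _) = 1
𝟙 (no _)  = 0

module _ {a b} {A : Set a} {B : Set b} where

  𝟙-cong : A ⇔ B → (A? : Dec A) (B? : Dec B) → 𝟙 A? ≡ 𝟙 B?
  𝟙-cong A⇔B (yes _) (yes _) = refl
  𝟙-cong A⇔B (yes x) (no ¬y) = ⊥-elim (¬y (Equivalence.to A⇔B x))
  𝟙-cong A⇔B (no ¬x) (yes y) = ⊥-elim (¬x (Equivalence.from A⇔B y))
  𝟙-cong A⇔B (no _)  (no _)  = refl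

module _ {a} {A : Set a} where

  𝟙-yes : (A? : Dec A) → A → 𝟙 A? ≡ 1
  𝟙-yes (yes _) _ = refl
  𝟙-yes (no ¬x) x = ⊥-elim (¬x x)

  𝟙-no : (A? : Dec A) → ¬ A → 𝟙 A? ≡ 0
  𝟙-no (yes x) ¬x = ⊥-elim (¬x x)
  𝟙-no (no _)  _  = refl

  𝟙≤1 : (A? : Dec A) → 𝟙 A? ≤ 1
  𝟙≤1 (yes _) = s≤s z≤n
  𝟙≤1 (no _)  = z≤n

∑-const : ∀ n c → (∑[ i < n ] c) ≡ n * c
∑-const zero    c = refl
∑-const (suc n) c = cong (_+_ c) (∑-const n c)

∑≡sumTo : ∀ n (f : ℕ → ℕ) → ∑[ i < n ] (f (toℕ i)) ≡ sumTo n f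
∑≡sumTo zero    f = refl
∑≡sumTo (suc n) f = begin
  f 0 + ∑[ i < n ] (f (suc (toℕ i)))   ≡⟨ cong (_+_ (f 0)) (∑≡sumTo n (f ∘ suc)) ⟩
  f 0 + sumTo n (f ∘ suc)            ≡⟨ sumTo-split 1 n f ⟨
  sumTo (suc n) f                    ∎
  where open ≡-Reasoning

∑-𝟙-≟ : ∀ {n} (x : Fin n) → ∑[ i < n ] (𝟙 (x ≟ᶠ i)) ≡ 1
∑-𝟙-≟ {suc n} zero    = cong suc (trans (sum-cong-≗ {n} (λ i → 𝟙-no (zero ≟ᶠ suc i) λ ())) (trans (∑-const n 0) (*-zeroʳ n)))
∑-𝟙-≟ {suc n} (suc x) = trans (sum-cong-≗ {n} (λ i → 𝟙-cong (mk⇔ Fin-suc-injective (cong suc)) (suc x ≟ᶠ suc i) (x ≟ᶠ i))) (∑-𝟙-≟ x)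

length-filter-tabulate : ∀ {A : Set} {P : Pred A 0ℓ} (P? : Decidable P) n (f : Fin n → A) →
                         length (filter P? (tabulate f)) ≡ ∑[ i < n ] (𝟙 (P? (f i)))
length-filter-tabulate P? zero    f = refl
length-filter-tabulate P? (suc n) f with P? (f zero)
... | yes _ = cong suc (length-filter-tabulate P? n (f ∘ suc))
... | no _  = length-filter-tabulate P? n (f ∘ suc)

sumG : ∀ {p} k → (G p k → ℕ) → ℕ
sumG         zero    f = f []
sumG {p = p} (suc k) f = ∑[ i < p ] (sumG k (λ v → f (i ∷ v)))

module _ {p : ℕ} where

  sumG-cong : ∀ k {f g : G p k → ℕ} → (∀ v → f v ≡ g v) → sumG k f ≡ sumG k g
  sumG-cong zero    f≡g = f≡g []
  sumG-cong (suc k) f≡g = sum-cong-≗ {p} (λ i → sumG-cong k (λ v → f≡g (i ∷ v)))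

  sumG-const : ∀ k c → sumG {p} k (λ _ → c) ≡ p ^ k * c
  sumG-const zero    c = sym (+-identityʳ c)
  sumG-const (suc k) c = begin
    ∑[ i < p ] (sumG k (λ _ → c))   ≡⟨ sum-cong-≗ {p} (λ _ → sumG-const k c) ⟩
    ∑[ i < p ] (p ^ k * c)          ≡⟨ ∑-const p (p ^ k * c) ⟩
    p * (p ^ k * c)                 ≡⟨ *-assoc p (p ^ k) c ⟨
    p ^ suc k * c                   ∎
    where open ≡-Reasoning

  sumG-∑-comm : ∀ k n (F : G p k → Fin n → ℕ) →
                sumG k (λ g → ∑[ l < n ] (F g l)) ≡ ∑[ l < n ] (sumG k (λ g → F g l))
  sumG-∑-comm zero    n F = refl
  sumG-∑-comm (suc k) n F = trans (sum-cong-≗ {p} (λ i → sumG-∑-comm k n (λ v → F (i ∷ v))))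
                                  (∑-comm (λ i l → sumG k (λ v → F (i ∷ v) l)))

  sumG-𝟙-≟ : ∀ k (v : G p k) → sumG k (λ g → 𝟙 (v ≟G g)) ≡ 1
  sumG-𝟙-≟ zero    []       = refl
  sumG-𝟙-≟ (suc k) (x ∷ v) = trans (sum-cong-≗ {p} column) (∑-𝟙-≟ x)
    where
    column : ∀ i → sumG k (λ w → 𝟙 ((x ∷ v) ≟G (i ∷ w))) ≡ 𝟙 (x ≟ᶠ i)
    column i = by-cases (x ≟ᶠ i)
      where
      by-cases : (x≟i : Dec (x ≡ i)) → sumG k (λ w → 𝟙 ((x ∷ v) ≟G (i ∷ w))) ≡ 𝟙 x≟i
      by-cases (yes refl) = trans (sumG-cong k (λ w → 𝟙-cong (mk⇔ ∷-injectiveʳ (cong (x ∷_))) _ _)) (sumG-𝟙-≟ k v)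
      by-cases (no x≢i)   = trans (sumG-cong k (λ w → 𝟙-no _ (λ eq → x≢i (∷-injectiveˡ eq))))
                                  (trans (sumG-const k 0) (*-zeroʳ (p ^ k)))

module _ {p k r c : ℕ} .{{_ : NonZero p}} (D : Fin r → Fin c → G p k) (i j : Fin c) where

  sumG-countDiff : sumG k (countDiff D i j) ≡ r
  sumG-countDiff = begin
    sumG k (countDiff D i j)                                  ≡⟨ sumG-cong k (λ g → length-filter-tabulate (λ l → (D l i ⊖ D l j) ≟G g) r _) ⟩
    sumG k (λ g → ∑[ l < r ] (𝟙 ((D l i ⊖ D l j) ≟G g)))      ≡⟨ sumG-∑-comm k r _ ⟩
    ∑[ l < r ] (sumG k (λ g → 𝟙 ((D l i ⊖ D l j) ≟G g)))      ≡⟨ sum-cong-≗ {r} (λ l → sumG-𝟙-≟ k (D l i ⊖ D l j)) ⟩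
    ∑[ l < r ] 1                                              ≡⟨ trans (∑-const r 1) (*-identityʳ r) ⟩
    r                                                         ∎
    where open ≡-Reasoning

  differenceMatrix⇒countDiff : IsDifferenceMatrix D → i ≢ j → ∀ g → p ^ k * countDiff D i j g ≡ r
  differenceMatrix⇒countDiff isDM i≢j g = begin
    p ^ k * countDiff D i j g              ≡⟨ sumG-const k _ ⟨
    sumG k (λ _ → countDiff D i j g)       ≡⟨ sumG-cong k (isDM i j i≢j g) ⟩
    sumG k (countDiff D i j)               ≡⟨ sumG-countDiff ⟩
    r                                      ∎
    where open ≡-Reasoning

-- Averaging over periods

module _ (P q : ℕ) .{{_ : NonZero P}} {f g : ℕ → ℕ} {F : ℕ}
         (g≤f : ∀ x → g x ≤ f x)
         (block-f : ∀ w → sumTo P (λ y → f (P * w + y)) ≡ F)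
         (block-g : ∀ w → 1 ≤ w → q * sumTo P (λ y → g (P * w + y)) ≡ (q ∸ 1) * sumTo P (λ y → f (P * w + y)))
         where

  private
    block : (ℕ → ℕ) → ℕ → ℕ
    block h w = sumTo P (λ y → h (P * w + y))

    ≈-≤F : ∀ {A B} → A ≤ F → B ≤ F → q * A ≈[ q * F ] (q ∸ 1) * B
    ≈-≤F A≤F B≤F = ≈-bounded (*-monoʳ-≤ q A≤F) (*-mono-≤ (m∸n≤m q 1) B≤F)

    block-g≤F : ∀ w → block g w ≤ F
    block-g≤F w = ≤-trans (sumTo-mono-≤ P (λ y _ → g≤f (P * w + y))) (≤-reflexive (block-f w))

    whole-blocks : ∀ W → q * sumTo W (block g) ≈[ q * F ] (q ∸ 1) * sumTo W (block f)
    whole-blocks zero    = ≈-reflexive (q * F) (trans (*-zeroʳ q) (sym (*-zeroʳ (q ∸ 1))))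
    whole-blocks (suc W) =
      subst₂ (_≈[ q * F ]_) (split-* q g) (split-* (q ∸ 1) f)
        (≈-mono (≤-reflexive (+-identityʳ (q * F)))
          (≈-+ (≈-≤F (block-g≤F 0) (≤-reflexive (block-f 0)))
               (≈-reflexive 0 (begin
                 q * sumTo W (block g ∘ suc)              ≡⟨ sumTo-*ˡ W q _ ⟨
                 sumTo W (λ w → q * block g (suc w))      ≡⟨ sumTo-cong W (λ w _ → block-g (suc w) (s≤s z≤n)) ⟩
                 sumTo W (λ w → (q ∸ 1) * block f (suc w)) ≡⟨ sumTo-*ˡ W (q ∸ 1) _ ⟩
                 (q ∸ 1) * sumTo W (block f ∘ suc)        ∎))))
      where
      open ≡-Reasoning
      split-* : ∀ c h → c * block h 0 + c * sumTo W (block h ∘ suc) ≡ c * sumTo (suc W) (block h)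
      split-* c h = trans (sym (*-distribˡ-+ c _ _)) (cong (c *_) (sym (sumTo-split 1 W (block h))))

    blocks-and-rest : ∀ X (h : ℕ → ℕ) →
                      sumTo X h ≡ sumTo (X / P) (block h) + sumTo (X % P) (λ i → h (P * (X / P) + i))
    blocks-and-rest X h = begin
      sumTo X h                                                    ≡⟨ cong (λ n → sumTo n h) X≡ ⟩
      sumTo (P * (X / P) + X % P) h                                ≡⟨ sumTo-split (P * (X / P)) (X % P) h ⟩
      sumTo (P * (X / P)) h + sumTo (X % P) (λ i → h (P * (X / P) + i))
        ≡⟨ cong (_+ sumTo (X % P) (λ i → h (P * (X / P) + i))) (trans (cong (λ n → sumTo n h) (*-comm P (X / P))) (sumTo-blocks (X / P) P h)) ⟩
      sumTo (X / P) (block h) + sumTo (X % P) (λ i → h (P * (X / P) + i)) ∎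
      where
      open ≡-Reasoning
      X≡ : X ≡ P * (X / P) + X % P
      X≡ = trans (m≡m%n+[m/n]*n X P) (trans (+-comm (X % P) _) (cong (_+ X % P) (*-comm (X / P) P)))

    rest-f≤F : ∀ X → sumTo (X % P) (λ i → f (P * (X / P) + i)) ≤ F
    rest-f≤F X = ≤-trans (sumTo-prefix-≤ _ (<⇒≤ (m%n<n X P))) (≤-reflexive (block-f (X / P)))

    rest-g≤F : ∀ X → sumTo (X % P) (λ i → g (P * (X / P) + i)) ≤ F
    rest-g≤F X = ≤-trans (sumTo-mono-≤ (X % P) (λ i _ → g≤f (P * (X / P) + i))) (rest-f≤F X)

  periodic-average : ∀ X → q * sumTo X g ≈[ q * F + q * F ] (q ∸ 1) * sumTo X f
  periodic-average X = subst₂ (_≈[ q * F + q * F ]_) (split-* q g) (split-* (q ∸ 1) f)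
                         (≈-+ (whole-blocks (X / P)) (≈-≤F (rest-g≤F X) (rest-f≤F X)))
    where
    split-* : ∀ c h → c * sumTo (X / P) (block h) + c * sumTo (X % P) (λ i → h (P * (X / P) + i)) ≡ c * sumTo X h
    split-* c h = trans (sym (*-distribˡ-+ c _ _)) (cong (c *_) (sym (blocks-and-rest X h)))

-- Blocks and separation levels

module Blocks (q : ℕ) .{{_ : NonZero q}} where

  infixl 7 _/q^_ _%q^_

  _/q^_ : ℕ → ℕ → ℕ
  x /q^ s = _/_ x (q ^ s) {{m^n≢0 q s}}

  _%q^_ : ℕ → ℕ → ℕ
  x %q^ s = _%_ x (q ^ s) {{m^n≢0 q s}}

  /q^-suc : ∀ t x → x /q^ suc t ≡ (x /q^ t) / q
  /q^-suc t x = trans (/-congʳ {{m^n≢0 q (suc t)}} {{q^t*q≢0}} (*-comm q (q ^ t)))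
                      (sym (m/n/o≡m/[n*o] x (q ^ t) q {{m^n≢0 q t}} {{_}} {{q^t*q≢0}}))
    where
    q^t*q≢0 : NonZero (q ^ t * q)
    q^t*q≢0 = m*n≢0 (q ^ t) q {{m^n≢0 q t}}

  /q^-small : ∀ s {x} → x < q ^ s → x /q^ s ≡ 0
  /q^-small s = m<n⇒m/n≡0 {{m^n≢0 q s}}

  /q^-shift : ∀ s x j → (x + j * q ^ s) /q^ s ≡ x /q^ s + j
  /q^-shift s x j = trans (+-distrib-/-∣ʳ x {{m^n≢0 q s}} (n∣m*n j)) (cong (_+_ (x /q^ s)) (m*n/n≡m j (q ^ s) {{m^n≢0 q s}}))

  q^*/q^+%q^ : ∀ t x → q ^ t * (x /q^ t) + x %q^ t ≡ x
  q^*/q^+%q^ t x = trans (+-comm _ (x %q^ t)) (trans (cong (_+_ (x %q^ t)) (*-comm (q ^ t) _)) (sym (m≡m%n+[m/n]*n x (q ^ t) {{m^n≢0 q t}})))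

  %q^-< : ∀ t x → x %q^ t < q ^ t
  %q^-< t x = m%n<n x (q ^ t) {{m^n≢0 q t}}

  /q^-< : ∀ t {x} → x < q ^ suc t → x /q^ t < q
  /q^-< t = m<n*o⇒m/o<n {{m^n≢0 q t}}

module Levels (q d : ℕ) .{{_ : NonZero q}} where

  open Blocks q

  sameBlock : ℕ → ℕ → ℕ
  sameBlock s x = 𝟙 (x /q^ s ≟ (x + d) /q^ s)

  -- sameBlock is monotone in s, so level t x is 1 exactly when x and x + d lie in
  -- the same block of length q ^ (t + 1) but in different blocks of length q ^ t.
  level : ℕ → ℕ → ℕ
  level t x = sameBlock (suc t) x ∸ sameBlock t x

  sameBlock≤1 : ∀ s x → sameBlock s x ≤ 1
  sameBlock≤1 s x = 𝟙≤1 (x /q^ s ≟ (x + d) /q^ s)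

  sameBlock-mono : ∀ t x → sameBlock t x ≤ sameBlock (suc t) x
  sameBlock-mono t x = by-cases (x /q^ t ≟ (x + d) /q^ t)
    where
    by-cases : (same? : Dec (x /q^ t ≡ (x + d) /q^ t)) → 𝟙 same? ≤ sameBlock (suc t) x
    by-cases (yes eq) = ≤-reflexive (sym (𝟙-yes _ (trans (/q^-suc t x) (trans (cong (_/ q) eq) (sym (/q^-suc t (x + d)))))))
    by-cases (no _)   = z≤n

  level≤1 : ∀ t x → level t x ≤ 1
  level≤1 t x = ≤-trans (m∸n≤m (sameBlock (suc t) x) (sameBlock t x)) (sameBlock≤1 (suc t) x)

  sumTo-level : ∀ B x → sumTo B (λ t → level t x) + sameBlock 0 x ≡ sameBlock B x
  sumTo-level zero    x = refl
  sumTo-level (suc B) x = begin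
    sumTo B (λ t → level t x) + level B x + sameBlock 0 x    ≡⟨ xy∙z≈xz∙y (sumTo B (λ t → level t x)) (level B x) (sameBlock 0 x) ⟩
    sumTo B (λ t → level t x) + sameBlock 0 x + level B x    ≡⟨ cong (_+ level B x) (sumTo-level B x) ⟩
    sameBlock B x + level B x                                ≡⟨ m+[n∸m]≡n (sameBlock-mono B x) ⟩
    sameBlock (suc B) x                                      ∎
    where open ≡-Reasoning

  sameBlock-large : ∀ s x → x + d < q ^ s → sameBlock s x ≡ 1
  sameBlock-large s x x+d<q^s = 𝟙-yes (x /q^ s ≟ (x + d) /q^ s) (trans (/q^-small s (≤-trans (s≤s (m≤m+n x d)) x+d<q^s)) (sym (/q^-small s x+d<q^s)))

  sumTo-level≡1 : 1 ≤ d → ∀ B x → x + d < q ^ B → sumTo B (λ t → level t x) ≡ 1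
  sumTo-level≡1 1≤d B x x+d<q^B = begin
    sumTo B (λ t → level t x)                   ≡⟨ +-identityʳ _ ⟨
    sumTo B (λ t → level t x) + 0               ≡⟨ cong (_+_ (sumTo B (λ t → level t x))) separated ⟨
    sumTo B (λ t → level t x) + sameBlock 0 x   ≡⟨ sumTo-level B x ⟩
    sameBlock B x                               ≡⟨ sameBlock-large B x x+d<q^B ⟩
    1                                           ∎
    where
    open ≡-Reasoning
    separated : sameBlock 0 x ≡ 0
    separated = 𝟙-no _ (λ eq → <⇒≢ (m<m+n x 1≤d) (trans (sym (n/1≡n x)) (trans eq (n/1≡n (x + d)))))

  level-small : ∀ t x → x + d < q ^ t → level t x ≡ 0
  level-small t x x+d<q^t = trans (cong (sameBlock (suc t) x ∸_) (sameBlock-large t x x+d<q^t)) (m≤n⇒m∸n≡0 (sameBlock≤1 (suc t) x))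

  sameBlock-periodic : ∀ s x j → sameBlock s (x + j * q ^ s) ≡ sameBlock s x
  sameBlock-periodic s x j = 𝟙-cong (mk⇔ unshift shift) _ _
    where
    x+d+jQ : x + j * q ^ s + d ≡ (x + d) + j * q ^ s
    x+d+jQ = xy∙z≈xz∙y x (j * q ^ s) d
    unshift : (x + j * q ^ s) /q^ s ≡ (x + j * q ^ s + d) /q^ s → x /q^ s ≡ (x + d) /q^ s
    unshift eq = +-cancelʳ-≡ j _ _ (begin
      x /q^ s + j                  ≡⟨ /q^-shift s x j ⟨
      (x + j * q ^ s) /q^ s        ≡⟨ eq ⟩
      (x + j * q ^ s + d) /q^ s    ≡⟨ cong (_/q^ s) x+d+jQ ⟩
      (x + d + j * q ^ s) /q^ s    ≡⟨ /q^-shift s (x + d) j ⟩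
      (x + d) /q^ s + j            ∎)
      where open ≡-Reasoning
    shift : x /q^ s ≡ (x + d) /q^ s → (x + j * q ^ s) /q^ s ≡ (x + j * q ^ s + d) /q^ s
    shift eq = begin
      (x + j * q ^ s) /q^ s        ≡⟨ /q^-shift s x j ⟩
      x /q^ s + j                  ≡⟨ cong (_+ j) eq ⟩
      (x + d) /q^ s + j            ≡⟨ /q^-shift s (x + d) j ⟨
      (x + d + j * q ^ s) /q^ s    ≡⟨ cong (_/q^ s) x+d+jQ ⟨
      (x + j * q ^ s + d) /q^ s    ∎
      where open ≡-Reasoning

  level-periodic : ∀ t m ρ → level t (q ^ suc t * m + ρ) ≡ level t ρ
  level-periodic t m ρ = begin
    level t (q ^ suc t * m + ρ)                                  ≡⟨ cong (level t) (trans (+-comm _ ρ) (cong (_+_ ρ) (*-comm (q ^ suc t) m))) ⟩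
    sameBlock (suc t) (ρ + m * q ^ suc t) ∸ sameBlock t (ρ + m * q ^ suc t)
      ≡⟨ cong₂ _∸_ (sameBlock-periodic (suc t) ρ m)
                   (trans (cong (λ y → sameBlock t (ρ + y)) (sym (*-assoc m q (q ^ t)))) (sameBlock-periodic t ρ (m * q))) ⟩
    level t ρ                                                    ∎
    where open ≡-Reasoning

  level≡1⇒ : ∀ t x → level t x ≡ 1 → x /q^ suc t ≡ (x + d) /q^ suc t × x /q^ t ≢ (x + d) /q^ t
  level≡1⇒ t x = by-cases (x /q^ suc t ≟ (x + d) /q^ suc t) (x /q^ t ≟ (x + d) /q^ t)
    where
    by-cases : (same₁? : Dec (x /q^ suc t ≡ (x + d) /q^ suc t)) (same₀? : Dec (x /q^ t ≡ (x + d) /q^ t)) →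
               𝟙 same₁? ∸ 𝟙 same₀? ≡ 1 → x /q^ suc t ≡ (x + d) /q^ suc t × x /q^ t ≢ (x + d) /q^ t
    by-cases (yes same₁) (no ¬same₀) _ = same₁ , ¬same₀
    by-cases (yes _)     (yes _)     ()
    by-cases (no _)      (yes _)     ()
    by-cases (no _)      (no _)      ()

  level≡1⇒<q^suc : ∀ t x → x < q ^ suc t → level t x ≡ 1 → x + d < q ^ suc t
  level≡1⇒<q^suc t x x<q^suc level≡1 =
    m/n≡0⇒m<n {{m^n≢0 q (suc t)}} (trans (sym (proj₁ (level≡1⇒ t x level≡1))) (/q^-small (suc t) x<q^suc))

  levelMass : ℕ → ℕ
  levelMass t = sumTo (q ^ suc t) (level t)

  levelMass≤q^suc : ∀ t → levelMass t ≤ q ^ suc t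
  levelMass≤q^suc t = begin
    sumTo (q ^ suc t) (level t)       ≤⟨ sumTo-mono-≤ (q ^ suc t) (λ x _ → level≤1 t x) ⟩
    sumTo (q ^ suc t) (λ _ → 1)       ≡⟨ sumTo-const (q ^ suc t) 1 ⟩
    q ^ suc t * 1                     ≡⟨ *-identityʳ (q ^ suc t) ⟩
    q ^ suc t                         ∎
    where open ≤-Reasoning

  level+/q^≤/q^ : ∀ t x → level t x + x /q^ t ≤ (x + d) /q^ t
  level+/q^≤/q^ t x = by-cases (x /q^ t ≟ (x + d) /q^ t)
    where
    by-cases : (same₀? : Dec (x /q^ t ≡ (x + d) /q^ t)) → (sameBlock (suc t) x ∸ 𝟙 same₀?) + x /q^ t ≤ (x + d) /q^ t
    by-cases (yes eq)     = ≤-reflexive (trans (cong (_+ x /q^ t) (m≤n⇒m∸n≡0 (sameBlock≤1 (suc t) x))) eq)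
    by-cases (no x≢x+d)   = ≤-trans (+-monoˡ-≤ (x /q^ t) (sameBlock≤1 (suc t) x))
                                    (≤∧≢⇒< (/-monoˡ-≤ (q ^ t) {{m^n≢0 q t}} (m≤m+n x d)) x≢x+d)

  -- Over a period, ⌊(x + d) / q ^ t⌋ − ⌊x / q ^ t⌋ sums to d * q.
  levelMass≤q*d : ∀ t → levelMass t ≤ q * d
  levelMass≤q*d t = +-cancelʳ-≤ (sumTo Q φ) (levelMass t) (q * d) (begin
    levelMass t + sumTo Q φ                 ≡⟨ sumTo-distrib-+ Q ⟨
    sumTo Q (λ x → level t x + φ x)         ≤⟨ sumTo-mono-≤ Q (λ x _ → level+/q^≤/q^ t x) ⟩
    sumTo Q (λ x → φ (x + d))               ≡⟨ +-cancelʳ-≡ (sumTo d φ) _ _ shifted ⟩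
    q * d + sumTo Q φ                       ∎)
    where
    open ≤-Reasoning
    Q : ℕ
    Q = q ^ suc t
    φ : ℕ → ℕ
    φ x = x /q^ t
    regroup : ∀ a b d q → a + (b + d * q) ≡ q * d + a + b
    regroup = solve-∀
    shifted : sumTo Q (λ x → φ (x + d)) + sumTo d φ ≡ q * d + sumTo Q φ + sumTo d φ
    shifted = begin-equality
      sumTo Q (λ x → φ (x + d)) + sumTo d φ      ≡⟨ sumTo-shift Q d φ ⟩
      sumTo Q φ + sumTo d (λ i → φ (Q + i))      ≡⟨ cong (_+_ (sumTo Q φ)) (sumTo-cong d (λ i _ → trans (cong φ (+-comm Q i)) (/q^-shift t i q))) ⟩
      sumTo Q φ + sumTo d (λ i → φ i + q)        ≡⟨ cong (_+_ (sumTo Q φ)) (trans (sumTo-distrib-+ d) (cong (_+_ (sumTo d φ)) (sumTo-const d q))) ⟩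
      sumTo Q φ + (sumTo d φ + d * q)            ≡⟨ regroup (sumTo Q φ) (sumTo d φ) d q ⟩
      q * d + sumTo Q φ + sumTo d φ              ∎

  levelMass≤q*[q^t⊓d] : ∀ t → levelMass t ≤ q * (q ^ t ⊓ d)
  levelMass≤q*[q^t⊓d] t = ≤-trans (⊓-glb (levelMass≤q^suc t) (levelMass≤q*d t)) (≤-reflexive (sym (*-distribˡ-⊓ q (q ^ t) d)))

module LevelWeights (q d Y : ℕ) (q≥2 : 2 ≤ q) where

  levelWeight : ℕ → ℕ
  levelWeight t = 𝟙 (q ^ t <? Y) * (q ^ t ⊓ d)

  smallPowers : ℕ → ℕ
  smallPowers B = sumTo B (λ t → 𝟙 (q ^ t ≤? d) * q ^ t)

  middleLevels : ℕ → ℕ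
  middleLevels B = sumTo B (λ t → 𝟙 (d <? q ^ t) * 𝟙 (q ^ t <? Y))

  levelWeight≤ : ∀ t → levelWeight t ≤ 𝟙 (q ^ t ≤? d) * q ^ t + d * (𝟙 (d <? q ^ t) * 𝟙 (q ^ t <? Y))
  levelWeight≤ t with q ^ t <? Y | q ^ t ≤? d | d <? q ^ t
  ... | no _  | _        | _        = z≤n
  ... | yes _ | yes _    | mid?     = begin
    1 * (q ^ t ⊓ d)           ≡⟨ *-identityˡ _ ⟩
    q ^ t ⊓ d                 ≤⟨ m⊓n≤m (q ^ t) d ⟩
    q ^ t                     ≡⟨ *-identityˡ _ ⟨
    1 * q ^ t                 ≤⟨ m≤m+n _ _ ⟩
    1 * q ^ t + d * (𝟙 mid? * 1) ∎
    where open ≤-Reasoning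
  ... | yes _ | no _     | yes _    = begin
    1 * (q ^ t ⊓ d)           ≡⟨ *-identityˡ _ ⟩
    q ^ t ⊓ d                 ≤⟨ m⊓n≤n (q ^ t) d ⟩
    d                         ≡⟨ *-identityʳ d ⟨
    d * 1                     ∎
    where open ≤-Reasoning
  ... | yes _ | no q^t≰d | no d≮q^t = contradiction (≰⇒> q^t≰d) d≮q^t

  private
    q^B≤q^suc : ∀ B → q ^ B ≤ q ^ suc B
    q^B≤q^suc B = m≤n*m (q ^ B) q {{>-nonZero (≤-trans (s≤s z≤n) q≥2)}}

    2*q^B≤q^suc : ∀ B → 2 * q ^ B ≤ q ^ suc B
    2*q^B≤q^suc B = *-monoˡ-≤ (q ^ B) q≥2

  smallPowers-bound : ∀ B → smallPowers B < q ^ B × smallPowers B ≤ 2 * d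
  smallPowers-bound zero    = s≤s z≤n , z≤n
  smallPowers-bound (suc B) with q ^ B ≤? d | smallPowers-bound B
  ... | yes q^B≤d | S<q^B , _    = ≤-trans S′<2q^B (2*q^B≤q^suc B) , ≤-trans (<⇒≤ S′<2q^B) (*-monoʳ-≤ 2 q^B≤d)
    where
    S′<2q^B : smallPowers B + 1 * q ^ B < 2 * q ^ B
    S′<2q^B = begin-strict
      smallPowers B + 1 * q ^ B   ≡⟨ cong (_+_ (smallPowers B)) (*-identityˡ (q ^ B)) ⟩
      smallPowers B + q ^ B       <⟨ +-monoˡ-< (q ^ B) S<q^B ⟩
      q ^ B + q ^ B               ≡⟨ cong (_+_ (q ^ B)) (+-identityʳ (q ^ B)) ⟨
      2 * q ^ B                   ∎
      where open ≤-Reasoning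
  ... | no _      | S<q^B , S≤2d = ≤-trans (≤-reflexive (+-identityʳ _)) (≤-trans S<q^B (q^B≤q^suc B)) ,
                                   ≤-trans (≤-reflexive (+-identityʳ _)) S≤2d

  sumTo-levelWeight≤ : ∀ B → sumTo B levelWeight ≤ 2 * d + d * middleLevels B
  sumTo-levelWeight≤ B = begin
    sumTo B levelWeight                                  ≤⟨ sumTo-mono-≤ B (λ t _ → levelWeight≤ t) ⟩
    sumTo B (λ t → 𝟙 (q ^ t ≤? d) * q ^ t + d * mid t)   ≡⟨ sumTo-distrib-+ B ⟩
    smallPowers B + sumTo B (λ t → d * mid t)            ≡⟨ cong (_+_ (smallPowers B)) (sumTo-*ˡ B d mid) ⟩
    smallPowers B + d * middleLevels B                   ≤⟨ +-monoˡ-≤ _ (proj₂ (smallPowers-bound B)) ⟩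
    2 * d + d * middleLevels B                           ∎
    where
    open ≤-Reasoning
    mid : ℕ → ℕ
    mid t = 𝟙 (d <? q ^ t) * 𝟙 (q ^ t <? Y)

  private
    unchanged : ∀ {B} → d * 2 ^ middleLevels B ≤ d ⊔ (q ^ B ⊓ (2 * Y)) → d * 2 ^ (middleLevels B + 0) ≤ d ⊔ (q ^ suc B ⊓ (2 * Y))
    unchanged {B} IH = ≤-trans (≤-reflexive (cong (λ m → d * 2 ^ m) (+-identityʳ (middleLevels B))))
                               (≤-trans IH (⊔-monoʳ-≤ d (⊓-monoˡ-≤ (2 * Y) (q^B≤q^suc B))))

  -- At a middle level t we have d < q ^ t < Y, so doubling the left-hand side keeps it below 2 * q ^ t.
  middleLevels-invariant : ∀ B → d * 2 ^ middleLevels B ≤ d ⊔ (q ^ B ⊓ (2 * Y))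
  middleLevels-invariant zero    = ≤-trans (≤-reflexive (*-identityʳ d)) (m≤m⊔n d _)
  middleLevels-invariant (suc B) with d <? q ^ B | q ^ B <? Y | middleLevels-invariant B
  ... | yes d<q^B | yes q^B<Y | IH = begin
    d * 2 ^ (middleLevels B + 1)     ≡⟨ double d (middleLevels B) ⟩
    2 * (d * 2 ^ middleLevels B)     ≤⟨ *-monoʳ-≤ 2 IH ⟩
    2 * (d ⊔ (q ^ B ⊓ (2 * Y)))        ≤⟨ *-monoʳ-≤ 2 (⊔-lub (<⇒≤ d<q^B) (m⊓n≤m (q ^ B) _)) ⟩
    2 * q ^ B                        ≤⟨ ⊓-glb (2*q^B≤q^suc B) (*-monoʳ-≤ 2 (<⇒≤ q^B<Y)) ⟩
    q ^ suc B ⊓ (2 * Y)                ≤⟨ m≤n⊔m d _ ⟩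
    d ⊔ (q ^ suc B ⊓ (2 * Y))          ∎
    where
    open ≤-Reasoning
    double : ∀ d m → d * 2 ^ (m + 1) ≡ 2 * (d * 2 ^ m)
    double d m rewrite +-comm m 1 = x*[2*y]≡2*[x*y] d (2 ^ m)
      where
      x*[2*y]≡2*[x*y] : ∀ x y → x * (2 * y) ≡ 2 * (x * y)
      x*[2*y]≡2*[x*y] = solve-∀
  ... | yes _ | no _  | IH = unchanged {B} IH
  ... | no _  | _     | IH = unchanged {B} IH

  middleLevels-bound : ∀ B → d * 2 ^ middleLevels B ≤ d + 2 * Y
  middleLevels-bound B = ≤-trans (middleLevels-invariant B) (≤-trans (⊔-monoʳ-≤ d (m⊓n≤n _ _)) (m⊔n≤m+n d _))

n<2^n : ∀ n → n < 2 ^ n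
n<2^n zero    = s≤s z≤n
n<2^n (suc n) = begin-strict
  suc n                  ≡⟨ +-comm 1 n ⟩
  n + 1                  <⟨ +-mono-<-≤ (n<2^n n) (m^n>0 2 n) ⟩
  2 ^ n + 2 ^ n          ≡⟨ cong (_+_ (2 ^ n)) (+-identityʳ (2 ^ n)) ⟨
  2 ^ suc n              ∎
  where open ≤-Reasoning

private
  x+2x≡3x : ∀ x → x + 2 * x ≡ 3 * x
  x+2x≡3x = solve-∀

  x+2[x+3x]≡9x : ∀ x → x + 2 * (x + 3 * x) ≡ 9 * x
  x+2[x+3x]≡9x = solve-∀

  x+2[x+y]≡3x+2y : ∀ x y → x + 2 * (x + y) ≡ 3 * x + 2 * y
  x+2[x+y]≡3x+2y = solve-∀

  x+3x≡4x : ∀ x → x + 3 * x ≡ 4 * x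
  x+3x≡4x = solve-∀

module _ (d′ : ℕ) where

  private
    d : ℕ
    d = suc d′

  *n≤*2^n : ∀ c → d * c ≤ d * 2 ^ c
  *n≤*2^n c = *-monoʳ-≤ d (<⇒≤ (n<2^n c))

  *2^≤⇒≤log₂ : ∀ N c → d * 2 ^ c ≤ N → c ≤ ⌊log₂ (N / d) ⌋
  *2^≤⇒≤log₂ N c d2^c≤N = begin
    c                    ≡⟨ ⌊log₂[2^n]⌋≡n c ⟨
    ⌊log₂ (2 ^ c) ⌋      ≤⟨ ⌊log₂⌋-mono-≤ 2^c≤N/d ⟩
    ⌊log₂ (N / d) ⌋      ∎
    where
    open ≤-Reasoning
    2^c≤N/d : 2 ^ c ≤ N / d
    2^c≤N/d = ≤-trans (≤-reflexive (sym (m*n/n≡m (2 ^ c) d))) (/-monoˡ-≤ d (≤-trans (≤-reflexive (*-comm (2 ^ c) d)) d2^c≤N))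

  *2^≤4*⇒≤2+log₂ : ∀ N c → d * 2 ^ c ≤ 4 * N → c ≤ 2 + ⌊log₂ (N / d) ⌋
  *2^≤4*⇒≤2+log₂ N zero          _ = z≤n
  *2^≤4*⇒≤2+log₂ N (suc zero)    _ = s≤s z≤n
  *2^≤4*⇒≤2+log₂ N (suc (suc c)) h = s≤s (s≤s (*2^≤⇒≤log₂ N c (*-cancelˡ-≤ 4 (≤-trans (≤-reflexive (four d (2 ^ c))) h))))
    where
    four : ∀ d x → 4 * (d * x) ≡ d * (2 * (2 * x))
    four = solve-∀

  module _ (r₁ : ℕ) where

    private
      r : ℕ
      r = r₁ + d

      d≤r : d ≤ r
      d≤r = m≤n+m d r₁

    start-bound : ∀ c → d * 2 ^ c ≤ d + 2 * r → d * c ≤ 3 * r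
    start-bound c h = begin
      d * c          ≤⟨ *n≤*2^n c ⟩
      d * 2 ^ c      ≤⟨ h ⟩
      d + 2 * r      ≤⟨ +-monoˡ-≤ (2 * r) d≤r ⟩
      r + 2 * r      ≡⟨ x+2x≡3x r ⟩
      3 * r          ∎
      where open ≤-Reasoning

    end-bound : ∀ N c → d * 2 ^ c ≤ d + 2 * (r₁ + N + d) → d * c ≤ 9 * r + d * (2 + ⌊log₂ (N / d) ⌋)
    end-bound N c h with N ≤? 3 * r
    ... | yes N≤3r = begin
      d * c                     ≤⟨ *n≤*2^n c ⟩
      d * 2 ^ c                 ≤⟨ h ⟩
      d + 2 * (r₁ + N + d)      ≡⟨ cong (λ y → d + 2 * y) (xy∙z≈xz∙y r₁ N d) ⟩
      d + 2 * (r + N)           ≤⟨ +-mono-≤ d≤r (*-monoʳ-≤ 2 (+-monoʳ-≤ r N≤3r)) ⟩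
      r + 2 * (r + 3 * r)       ≡⟨ x+2[x+3x]≡9x r ⟩
      9 * r                     ≤⟨ m≤m+n _ _ ⟩
      9 * r + d * (2 + ⌊log₂ (N / d) ⌋) ∎
      where open ≤-Reasoning
    ... | no N≰3r = ≤-trans (*-monoʳ-≤ d (*2^≤4*⇒≤2+log₂ N c d2^c≤4N)) (m≤n+m _ (9 * r))
      where
      open ≤-Reasoning
      d2^c≤4N : d * 2 ^ c ≤ 4 * N
      d2^c≤4N = begin
        d * 2 ^ c                 ≤⟨ h ⟩
        d + 2 * (r₁ + N + d)      ≡⟨ cong (λ y → d + 2 * y) (xy∙z≈xz∙y r₁ N d) ⟩
        d + 2 * (r + N)           ≤⟨ +-monoˡ-≤ (2 * (r + N)) d≤r ⟩
        r + 2 * (r + N)           ≡⟨ x+2[x+y]≡3x+2y r N ⟩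
        3 * r + 2 * N             ≤⟨ +-monoˡ-≤ (2 * N) (<⇒≤ (≰⇒> N≰3r)) ⟩
        N + 2 * N                 ≤⟨ +-monoʳ-≤ N (*-monoˡ-≤ N (s≤s (s≤s (z≤n {1})))) ⟩
        N + 3 * N                 ≡⟨ x+3x≡4x N ⟩
        4 * N                     ∎

    window-error≤ : ∀ N c₀ c₁ → d * 2 ^ c₀ ≤ d + 2 * r → d * 2 ^ c₁ ≤ d + 2 * (r₁ + N + d) →
                    2 * d + d * c₀ + (2 * d + d * c₁) ≤ 12 * (d * (1 + ⌊log₂ (N / d) ⌋) + r)
    window-error≤ N c₀ c₁ h₀ h₁ = begin
      2 * d + d * c₀ + (2 * d + d * c₁)
        ≤⟨ +-mono-≤ (+-monoʳ-≤ (2 * d) (start-bound c₀ h₀)) (+-monoʳ-≤ (2 * d) (end-bound N c₁ h₁)) ⟩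
      2 * d + 3 * r + (2 * d + (9 * r + d * (2 + L)))      ≤⟨ m≤m+n _ _ ⟩
      2 * d + 3 * r + (2 * d + (9 * r + d * (2 + L))) + (6 * d + 11 * (d * L))   ≡⟨ regroup d r L ⟩
      12 * (d * (1 + L) + r)                               ∎
      where
      open ≤-Reasoning
      L : ℕ
      L = ⌊log₂ (N / d) ⌋
      regroup : ∀ d r L → 2 * d + 3 * r + (2 * d + (9 * r + d * (2 + L))) + (6 * d + 11 * (d * L)) ≡ 12 * (d * (1 + L) + r)
      regroup = solve-∀

-- The Rudin–Shapiro sequence

κ : ℕ → ℕ
κ q = 2 * (q * q * q)

module RudinShapiro {p k : ℕ} .{{_ : NonZero p}}
                    (M : Fin (p ^ k) → Fin (p ^ k) → G p k) (a : ℕ → G p k) (isRS : IsRudinShapiro p k M a) where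

  q : ℕ
  q = p ^ k

  instance
    q≢0 : NonZero q
    q≢0 = m^n≢0 p k

  open Blocks q

  g : ℕ → ℕ → G p k
  g = gM p k M

  a-step : ∀ n j → j < q → 1 ≤ n → a (q * n + j) ≡ a n ⊕ g j n
  a-step n j j<q 1≤n = isRS n j j<q (λ { (_ , refl) → 1≰0 1≤n })
    where
    1≰0 : ¬ 1 ≤ 0
    1≰0 ()

  g-mod : ∀ j {n n′} → n % q ≡ n′ % q → g j n ≡ g j n′
  g-mod j n≡n′ = cong (λ row → M row (j mod q)) (toℕ-injective (trans (toℕ-fromℕ< _) (trans n≡n′ (sym (toℕ-fromℕ< _)))))

  [c*m+s]%q : ∀ c m s → (c * m + s) % q ≡ (c * (m % q) + s) % q
  [c*m+s]%q c m s = begin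
    (c * m + s) % q                                  ≡⟨ cong (λ n → (c * n + s) % q) (m≡m%n+[m/n]*n m q) ⟩
    (c * (m % q + m / q * q) + s) % q                ≡⟨ cong (_% q) (regroup c (m % q) (m / q) q s) ⟩
    (c * (m % q) + s + c * (m / q) * q) % q          ≡⟨ [m+kn]%n≡m%n _ (c * (m / q)) q ⟩
    (c * (m % q) + s) % q                            ∎
    where
    open ≡-Reasoning
    regroup : ∀ c r t q s → c * (r + t * q) + s ≡ c * r + s + c * t * q
    regroup = solve-∀

  increment : ℕ → ℕ → ℕ → G p k
  increment zero    u σ = 0̄
  increment (suc t) u σ = increment t u (σ / q) ⊕ g (σ % q) (q ^ t * u + σ / q)

  a-expand : ∀ t m σ → 1 ≤ m → σ < q ^ t → a (q ^ t * m + σ) ≡ a m ⊕ increment t (m % q) σ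
  a-expand zero    m (suc σ) 1≤m (s≤s ())
  a-expand zero    m zero    1≤m _ = trans (cong a (trans (+-identityʳ _) (+-identityʳ m))) (sym (⊕-identityʳ (a m)))
  a-expand (suc t) m σ 1≤m σ<q^suc = begin
    a (q ^ suc t * m + σ)                                ≡⟨ cong (λ s → a (q ^ suc t * m + s)) (m≡m%n+[m/n]*n σ q) ⟩
    a (q * q ^ t * m + (σ % q + σ / q * q))              ≡⟨ cong a (regroup q (q ^ t) m (σ / q) (σ % q)) ⟩
    a (q * (q ^ t * m + σ / q) + σ % q)                  ≡⟨ a-step _ (σ % q) (m%n<n σ q) (≤-trans (q^t*m≥1 t) (m≤m+n _ _)) ⟩
    a (q ^ t * m + σ / q) ⊕ g (σ % q) (q ^ t * m + σ / q)
      ≡⟨ cong₂ _⊕_ (a-expand t m (σ / q) 1≤m σ/q<q^t) (g-mod (σ % q) ([c*m+s]%q (q ^ t) m (σ / q))) ⟩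
    (a m ⊕ increment t (m % q) (σ / q)) ⊕ g (σ % q) (q ^ t * (m % q) + σ / q)
      ≡⟨ ⊕-assoc _ _ _ ⟩
    a m ⊕ increment (suc t) (m % q) σ                    ∎
    where
    open ≡-Reasoning
    regroup : ∀ q Q m t r → q * Q * m + (r + t * q) ≡ q * (Q * m + t) + r
    regroup = solve-∀
    q^t*m≥1 : ∀ t → 1 ≤ q ^ t * m
    q^t*m≥1 t = *-mono-≤ (m^n>0 q t) 1≤m
    σ/q<q^t : σ / q < q ^ t
    σ/q<q^t = m<n*o⇒m/o<n (subst (σ <_) (*-comm q (q ^ t)) σ<q^suc)

  a-expand-digit : ∀ t m u σ → 1 ≤ m → u < q → σ < q ^ t →
                   a (q ^ suc t * m + (q ^ t * u + σ)) ≡ (a m ⊕ g u m) ⊕ increment t u σ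
  a-expand-digit t m u σ 1≤m u<q σ<q^t = begin
    a (q ^ suc t * m + (q ^ t * u + σ))          ≡⟨ cong a (regroup q (q ^ t) m u σ) ⟩
    a (q ^ t * (q * m + u) + σ)                  ≡⟨ a-expand t (q * m + u) σ (≤-trans (*-mono-≤ (m^n>0 p k) 1≤m) (m≤m+n _ _)) σ<q^t ⟩
    a (q * m + u) ⊕ increment t ((q * m + u) % q) σ
      ≡⟨ cong₂ _⊕_ (a-step m u u<q 1≤m) (cong (λ v → increment t v σ) [q*m+u]%q≡u) ⟩
    (a m ⊕ g u m) ⊕ increment t u σ               ∎
    where
    open ≡-Reasoning
    regroup : ∀ q Q m u σ → q * Q * m + (Q * u + σ) ≡ Q * (q * m + u) + σ
    regroup = solve-∀
    [q*m+u]%q≡u : (q * m + u) % q ≡ u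
    [q*m+u]%q≡u = trans (cong (_% q) (trans (+-comm (q * m) u) (cong (_+_ u) (*-comm q m))))
                        (trans ([m+kn]%n≡m%n u m q) (m<n⇒m%n≡m u<q))

  module Gap (isDM : IsDifferenceMatrix M) (q≥2 : 2 ≤ q) (d′ : ℕ) where

    d : ℕ
    d = suc d′

    1≤d : 1 ≤ d
    1≤d = s≤s z≤n

    open Levels q d

    δ′ : ℕ → ℕ
    δ′ x = δ a x (x + d)

    δ+𝟙≡1 : ∀ x y → δ a x y + 𝟙 (a x ≟G a y) ≡ 1
    δ+𝟙≡1 x y with a x ≟G a y
    ... | yes _ = refl
    ... | no _  = refl

    agreement⇔rowDifference : ∀ t m ρ → 1 ≤ m → ρ < q ^ suc t → ρ + d < q ^ suc t →
             (a (q ^ suc t * m + ρ) ≡ a (q ^ suc t * m + ρ + d)) ⇔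
             (g ((ρ + d) /q^ t) m ⊖ g (ρ /q^ t) m
                ≡ increment t (ρ /q^ t) (ρ %q^ t) ⊖ increment t ((ρ + d) /q^ t) ((ρ + d) %q^ t))
    agreement⇔rowDifference t m ρ 1≤m ρ<Q ρ+d<Q =
      subst₂ (λ x y → (x ≡ y) ⇔ (g u′ m ⊖ g u m ≡ increment t u σ ⊖ increment t u′ σ′))
             (sym (expand ρ ρ<Q))
             (trans (sym (expand (ρ + d) ρ+d<Q)) (cong a (sym (+-assoc _ ρ d))))
             (⊕⊕≡⊕⊕⇔⊖≡⊖ (a m) _ _ _ _)
      where
      u σ u′ σ′ : ℕ
      u = ρ /q^ t
      σ = ρ %q^ t
      u′ = (ρ + d) /q^ t
      σ′ = (ρ + d) %q^ t
      expand : ∀ y → y < q ^ suc t → a (q ^ suc t * m + y) ≡ (a m ⊕ g (y /q^ t) m) ⊕ increment t (y /q^ t) (y %q^ t)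
      expand y y<Q = trans (cong (λ z → a (q ^ suc t * m + z)) (sym (q^*/q^+%q^ t y)))
                           (a-expand-digit t m (y /q^ t) (y %q^ t) 1≤m (/q^-< t y<Q) (%q^-< t y))

    agreements-in-column : ∀ t w ρ → 1 ≤ w → ρ < q ^ suc t → level t ρ ≡ 1 →
                           sumTo q (λ l → 𝟙 (a (q ^ suc t * (q * w + l) + ρ) ≟G a (q ^ suc t * (q * w + l) + ρ + d))) ≡ 1
    agreements-in-column t w ρ 1≤w ρ<Q level≡1 = begin
      sumTo q (λ l → 𝟙 (a (x l) ≟G a (x l + d)))           ≡⟨ sumTo-cong q (λ l _ → 𝟙-cong (agreement⇔rowDifference t (q * w + l) ρ (1≤qw+l l) ρ<Q ρ+d<Q) _ _) ⟩
      sumTo q (λ l → agrees (row l))                       ≡⟨ ∑≡sumTo q (agrees ∘ row) ⟨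
      ∑[ r < q ] (agrees (row (toℕ r)))                    ≡⟨ sum-cong-≗ {q} (λ r → cong agrees (row-toℕ r)) ⟩
      ∑[ r < q ] (agrees r)                                ≡⟨ length-filter-tabulate (λ r → (M r cu′ ⊖ M r cu) ≟G c) q id ⟨
      countDiff M cu′ cu c
        ≡⟨ *-cancelˡ-≡ _ 1 q (trans (differenceMatrix⇒countDiff M cu′ cu isDM cu′≢cu c) (sym (*-identityʳ q))) ⟩
      1                                                    ∎
      where
      open ≡-Reasoning
      x : ℕ → ℕ
      x l = q ^ suc t * (q * w + l) + ρ
      u u′ : ℕ
      u = ρ /q^ t
      u′ = (ρ + d) /q^ t
      cu cu′ : Fin q
      cu = u mod q
      cu′ = u′ mod q
      c : G p k
      c = increment t u (ρ %q^ t) ⊖ increment t u′ ((ρ + d) %q^ t)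
      row : ℕ → Fin q
      row l = (q * w + l) mod q
      agrees : Fin q → ℕ
      agrees r = 𝟙 ((M r cu′ ⊖ M r cu) ≟G c)
      ρ+d<Q : ρ + d < q ^ suc t
      ρ+d<Q = level≡1⇒<q^suc t ρ ρ<Q level≡1
      1≤qw+l : ∀ l → 1 ≤ q * w + l
      1≤qw+l l = ≤-trans (*-mono-≤ (m^n>0 p k) 1≤w) (m≤m+n _ l)
      row-toℕ : ∀ r → row (toℕ r) ≡ r
      row-toℕ r = toℕ-injective (begin
        toℕ (row (toℕ r))          ≡⟨ toℕ-fromℕ< _ ⟩
        (q * w + toℕ r) % q        ≡⟨ cong (_% q) (trans (+-comm (q * w) _) (cong (_+_ (toℕ r)) (*-comm q w))) ⟩
        (toℕ r + w * q) % q        ≡⟨ [m+kn]%n≡m%n (toℕ r) w q ⟩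
        toℕ r % q                  ≡⟨ m<n⇒m%n≡m (toℕ<n r) ⟩
        toℕ r                      ∎)
      cu′≢cu : cu′ ≢ cu
      cu′≢cu eq = proj₂ (level≡1⇒ t ρ level≡1) (begin
        u               ≡⟨ m<n⇒m%n≡m (/q^-< t ρ<Q) ⟨
        u % q           ≡⟨ toℕ-fromℕ< _ ⟨
        toℕ cu          ≡⟨ cong toℕ eq ⟨
        toℕ cu′         ≡⟨ toℕ-fromℕ< _ ⟩
        u′ % q          ≡⟨ m<n⇒m%n≡m (/q^-< t ρ+d<Q) ⟩
        u′              ∎)

    disagreements-in-column : ∀ t w ρ → 1 ≤ w → ρ < q ^ suc t → level t ρ ≡ 1 →
                              sumTo q (λ l → δ′ (q ^ suc t * (q * w + l) + ρ)) ≡ q ∸ 1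
    disagreements-in-column t w ρ 1≤w ρ<Q level≡1 = begin
      disagreements                     ≡⟨ m+n∸n≡m disagreements 1 ⟨
      disagreements + 1 ∸ 1             ≡⟨ cong (λ n → disagreements + n ∸ 1) (agreements-in-column t w ρ 1≤w ρ<Q level≡1) ⟨
      disagreements + agreements ∸ 1    ≡⟨ cong (_∸ 1) total ⟩
      q ∸ 1                             ∎
      where
      open ≡-Reasoning
      x : ℕ → ℕ
      x l = q ^ suc t * (q * w + l) + ρ
      disagreements agreements : ℕ
      disagreements = sumTo q (λ l → δ′ (x l))
      agreements = sumTo q (λ l → 𝟙 (a (x l) ≟G a (x l + d)))
      total : disagreements + agreements ≡ q
      total = begin
        disagreements + agreements                               ≡⟨ sumTo-distrib-+ q ⟨
        sumTo q (λ l → δ′ (x l) + 𝟙 (a (x l) ≟G a (x l + d)))    ≡⟨ sumTo-cong q (λ l _ → δ+𝟙≡1 (x l) (x l + d)) ⟩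
        sumTo q (λ _ → 1)                                        ≡⟨ sumTo-const q 1 ⟩
        q * 1                                                    ≡⟨ *-identityʳ q ⟩
        q                                                        ∎

    blockOf : ℕ → ℕ → ℕ
    blockOf t w = q ^ suc (suc t) * w

    sumTo-block : ∀ t w (h : ℕ → ℕ) → sumTo (q ^ suc (suc t)) (λ y → h (blockOf t w + y))
                                      ≡ sumTo q (λ l → sumTo (q ^ suc t) (λ ρ → h (q ^ suc t * (q * w + l) + ρ)))
    sumTo-block t w h = trans (sumTo-blocks q (q ^ suc t) _)
                              (sumTo-cong q (λ l _ → sumTo-cong (q ^ suc t) (λ ρ _ → cong h (regroup q (q ^ suc t) w l ρ))))
      where
      regroup : ∀ q Q w l ρ → q * Q * w + (Q * l + ρ) ≡ Q * (q * w + l) + ρ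
      regroup = solve-∀

    level-block : ∀ t w → sumTo (q ^ suc (suc t)) (λ y → level t (blockOf t w + y)) ≡ q * levelMass t
    level-block t w = begin
      sumTo (q ^ suc (suc t)) (λ y → level t (blockOf t w + y))                        ≡⟨ sumTo-block t w (level t) ⟩
      sumTo q (λ l → sumTo (q ^ suc t) (λ ρ → level t (q ^ suc t * (q * w + l) + ρ)))
        ≡⟨ sumTo-cong q (λ l _ → sumTo-cong (q ^ suc t) (λ ρ _ → level-periodic t (q * w + l) ρ)) ⟩
      sumTo q (λ _ → levelMass t)                                                       ≡⟨ sumTo-const q (levelMass t) ⟩
      q * levelMass t                                                                   ∎
      where open ≡-Reasoning

    separated-block : ∀ t w → 1 ≤ w →
      q * sumTo (q ^ suc (suc t)) (λ y → level t (blockOf t w + y) * δ′ (blockOf t w + y))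
        ≡ (q ∸ 1) * sumTo (q ^ suc (suc t)) (λ y → level t (blockOf t w + y))
    separated-block t w 1≤w = begin
      q * sumTo (q ^ suc (suc t)) (λ y → level t (blockOf t w + y) * δ′ (blockOf t w + y))
        ≡⟨ cong (q *_) (trans (sumTo-block t w (λ x → level t x * δ′ x)) (sumTo-swap q Q _)) ⟩
      q * sumTo Q (λ ρ → sumTo q (λ l → level t (x l ρ) * δ′ (x l ρ)))
        ≡⟨ cong (q *_) (sumTo-cong Q (λ ρ ρ<Q → column ρ ρ<Q)) ⟩
      q * sumTo Q (λ ρ → (q ∸ 1) * level t ρ)
        ≡⟨ cong (q *_) (sumTo-*ˡ Q (q ∸ 1) (level t)) ⟩
      q * ((q ∸ 1) * levelMass t)
        ≡⟨ x*[y*z]≡y*[x*z] q (q ∸ 1) (levelMass t) ⟩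
      (q ∸ 1) * (q * levelMass t)
        ≡⟨ cong ((q ∸ 1) *_) (level-block t w) ⟨
      (q ∸ 1) * sumTo (q ^ suc (suc t)) (λ y → level t (blockOf t w + y)) ∎
      where
      open ≡-Reasoning
      Q : ℕ
      Q = q ^ suc t
      x : ℕ → ℕ → ℕ
      x l ρ = Q * (q * w + l) + ρ
      x*[y*z]≡y*[x*z] : ∀ x y z → x * (y * z) ≡ y * (x * z)
      x*[y*z]≡y*[x*z] = solve-∀
      column : ∀ ρ → ρ < Q → sumTo q (λ l → level t (x l ρ) * δ′ (x l ρ)) ≡ (q ∸ 1) * level t ρ
      column ρ ρ<Q = begin
        sumTo q (λ l → level t (x l ρ) * δ′ (x l ρ))   ≡⟨ sumTo-cong q (λ l _ → cong (_* δ′ (x l ρ)) (level-periodic t (q * w + l) ρ)) ⟩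
        sumTo q (λ l → level t ρ * δ′ (x l ρ))         ≡⟨ sumTo-*ˡ q (level t ρ) (λ l → δ′ (x l ρ)) ⟩
        level t ρ * sumTo q (λ l → δ′ (x l ρ))         ≡⟨ by-level (n≤1⇒n≡0∨n≡1 (level≤1 t ρ)) ⟩
        level t ρ * (q ∸ 1)                            ≡⟨ *-comm (level t ρ) (q ∸ 1) ⟩
        (q ∸ 1) * level t ρ                            ∎
        where
        by-level : level t ρ ≡ 0 ⊎ level t ρ ≡ 1 → level t ρ * sumTo q (λ l → δ′ (x l ρ)) ≡ level t ρ * (q ∸ 1)
        by-level (inj₁ level≡0) = trans (cong (_* sumTo q (λ l → δ′ (x l ρ))) level≡0) (sym (cong (_* (q ∸ 1)) level≡0))
        by-level (inj₂ level≡1) = cong (level t ρ *_) (disagreements-in-column t w ρ 1≤w ρ<Q level≡1)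

    midLevels : ℕ → ℕ
    midLevels X = LevelWeights.middleLevels q d (X + d) q≥2 (X + d)

    δ′≤1 : ∀ x → δ′ x ≤ 1
    δ′≤1 x = m+n≤o⇒m≤o (δ′ x) (≤-reflexive (δ+𝟙≡1 x (x + d)))

    level-approx : ∀ X t → q * sumTo X (λ x → level t x * δ′ x)
                             ≈[ κ q * LevelWeights.levelWeight q d (X + d) q≥2 t ]
                           (q ∸ 1) * sumTo X (level t)
    level-approx X t = by-cases (q ^ t <? X + d)
      where
      by-cases : (low? : Dec (q ^ t < X + d)) →
                 q * sumTo X (λ x → level t x * δ′ x) ≈[ κ q * (𝟙 low? * (q ^ t ⊓ d)) ] (q ∸ 1) * sumTo X (level t)
      by-cases (yes _) = ≈-mono error≤
        (periodic-average (q ^ suc (suc t)) q {{m^n≢0 q (suc (suc t))}}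
          (λ x → ≤-trans (*-monoʳ-≤ (level t x) (δ′≤1 x)) (≤-reflexive (*-identityʳ (level t x))))
          (level-block t) (separated-block t) X)
        where
        error≤ : q * (q * levelMass t) + q * (q * levelMass t) ≤ κ q * (1 * (q ^ t ⊓ d))
        error≤ = begin
          q * (q * levelMass t) + q * (q * levelMass t)                  ≤⟨ +-mono-≤ bound bound ⟩
          q * (q * (q * (q ^ t ⊓ d))) + q * (q * (q * (q ^ t ⊓ d)))      ≡⟨ regroup q (q ^ t ⊓ d) ⟩
          κ q * (1 * (q ^ t ⊓ d))                                          ∎
          where
          open ≤-Reasoning
          bound : q * (q * levelMass t) ≤ q * (q * (q * (q ^ t ⊓ d)))
          bound = *-monoʳ-≤ q (*-monoʳ-≤ q (levelMass≤q*[q^t⊓d] t))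
          regroup : ∀ q w → q * (q * (q * w)) + q * (q * (q * w)) ≡ 2 * (q * q * q) * (1 * w)
          regroup = solve-∀
      by-cases (no q^t≮X+d) = ≈-reflexive _ (begin
        q * sumTo X (λ x → level t x * δ′ x)    ≡⟨ cong (q *_) (trans (sumTo-cong X (λ x x<X → cong (_* δ′ x) (vanishes x x<X))) (sumTo-zero X)) ⟩
        q * 0                                    ≡⟨ *-zeroʳ q ⟩
        0                                        ≡⟨ *-zeroʳ (q ∸ 1) ⟨
        (q ∸ 1) * 0                              ≡⟨ cong ((q ∸ 1) *_) (trans (sumTo-cong X vanishes) (sumTo-zero X)) ⟨
        (q ∸ 1) * sumTo X (level t)              ∎)
        where
        open ≡-Reasoning
        vanishes : ∀ x → x < X → level t x ≡ 0
        vanishes x x<X = level-small t x (≤-trans (+-monoˡ-< d x<X) (≮⇒≥ q^t≮X+d))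

    prefix-estimate : ∀ X → q * sumTo X δ′ ≈[ κ q * (2 * d + d * midLevels X) ] (q ∸ 1) * X
    prefix-estimate X =
      subst₂ (_≈[ κ q * (2 * d + d * middleLevels B) ]_) (sym split-δ′) (sym split-X)
        (≈-mono error≤ (≈-sumTo B (λ t _ → level-approx X t)))
      where
      open LevelWeights q d (X + d) q≥2
      B : ℕ
      B = X + d
      separates-once : ∀ x → x < X → sumTo B (λ t → level t x) ≡ 1
      separates-once x x<X = sumTo-level≡1 1≤d B x (begin-strict
        x + d        <⟨ +-monoˡ-< d x<X ⟩
        B            <⟨ n<2^n B ⟩
        2 ^ B        ≤⟨ ^-monoˡ-≤ B q≥2 ⟩
        q ^ B        ∎)
        where open ≤-Reasoning
      split-δ′ : q * sumTo X δ′ ≡ sumTo B (λ t → q * sumTo X (λ x → level t x * δ′ x))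
      split-δ′ = begin
        q * sumTo X δ′                                         ≡⟨ cong (q *_) (sumTo-cong X (λ x x<X → sym (weighted x x<X))) ⟩
        q * sumTo X (λ x → sumTo B (λ t → level t x * δ′ x))   ≡⟨ cong (q *_) (sumTo-swap X B _) ⟩
        q * sumTo B (λ t → sumTo X (λ x → level t x * δ′ x))   ≡⟨ sumTo-*ˡ B q _ ⟨
        sumTo B (λ t → q * sumTo X (λ x → level t x * δ′ x))   ∎
        where
        open ≡-Reasoning
        weighted : ∀ x → x < X → sumTo B (λ t → level t x * δ′ x) ≡ δ′ x
        weighted x x<X = begin
          sumTo B (λ t → level t x * δ′ x)    ≡⟨ sumTo-cong B (λ t _ → *-comm (level t x) (δ′ x)) ⟩
          sumTo B (λ t → δ′ x * level t x)    ≡⟨ sumTo-*ˡ B (δ′ x) (λ t → level t x) ⟩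
          δ′ x * sumTo B (λ t → level t x)    ≡⟨ cong (δ′ x *_) (separates-once x x<X) ⟩
          δ′ x * 1                            ≡⟨ *-identityʳ (δ′ x) ⟩
          δ′ x                                ∎
      split-X : (q ∸ 1) * X ≡ sumTo B (λ t → (q ∸ 1) * sumTo X (level t))
      split-X = begin
        (q ∸ 1) * X                                          ≡⟨ cong ((q ∸ 1) *_) (trans (sym (*-identityʳ X)) (sym (sumTo-const X 1))) ⟩
        (q ∸ 1) * sumTo X (λ _ → 1)                          ≡⟨ cong ((q ∸ 1) *_) (sumTo-cong X (λ x x<X → sym (separates-once x x<X))) ⟩
        (q ∸ 1) * sumTo X (λ x → sumTo B (λ t → level t x))  ≡⟨ cong ((q ∸ 1) *_) (sumTo-swap X B _) ⟩
        (q ∸ 1) * sumTo B (λ t → sumTo X (level t))          ≡⟨ sumTo-*ˡ B (q ∸ 1) _ ⟨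
        sumTo B (λ t → (q ∸ 1) * sumTo X (level t))          ∎
        where open ≡-Reasoning
      error≤ : sumTo B (λ t → κ q * levelWeight t) ≤ κ q * (2 * d + d * middleLevels B)
      error≤ = ≤-trans (≤-reflexive (sumTo-*ˡ B (κ q) levelWeight)) (*-monoʳ-≤ (κ q) (sumTo-levelWeight≤ B))

    midLevels-bound : ∀ X → d * 2 ^ midLevels X ≤ d + 2 * (X + d)
    midLevels-bound X = LevelWeights.middleLevels-bound q d (X + d) q≥2 (X + d)

    window-estimate : ∀ r₁ N → q * sumTo N (λ n → δ′ (r₁ + n))
                                ≈[ κ q * (2 * d + d * midLevels r₁ + (2 * d + d * midLevels (r₁ + N))) ]
                              (q ∸ 1) * N
    window-estimate r₁ N =
      ≈-mono (≤-reflexive (sym (*-distribˡ-+ (κ q) _ _)))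
        (≈-cancelˡ (prefix-estimate r₁)
          (subst₂ (_≈[ κ q * (2 * d + d * midLevels (r₁ + N)) ]_)
            (trans (cong (q *_) (sumTo-split r₁ N δ′)) (*-distribˡ-+ q _ _))
            (*-distribˡ-+ (q ∸ 1) r₁ N)
            (prefix-estimate (r₁ + N))))

    Sδ≡sumTo : ∀ r₁ N → Sδ a r₁ (r₁ + d) N ≡ sumTo N (λ n → δ′ (r₁ + n))
    Sδ≡sumTo r₁ zero    = refl
    Sδ≡sumTo r₁ (suc N) = cong₂ _+_ (Sδ≡sumTo r₁ N)
                                    (cong₂ (δ a) (+-comm N r₁) (trans (sym (+-assoc N r₁ d)) (cong (_+ d) (+-comm N r₁))))

    discrepancy : ∀ r₁ r₂ N → r₂ ≡ r₁ + d →
                  ∣ + (q * Sδ a r₁ r₂ N) - + (N * (q ∸ 1)) ∣ ≤ κ q * 12 * (d * (1 + ⌊log₂ (N / d) ⌋) + r₂)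
    discrepancy r₁ _ N refl = begin
      ∣ + (q * Sδ a r₁ (r₁ + d) N) - + (N * (q ∸ 1)) ∣
        ≤⟨ ≈⇒∣-∣≤ (subst₂ (_≈[ error ]_) (cong (q *_) (sym (Sδ≡sumTo r₁ N))) (*-comm (q ∸ 1) N) (window-estimate r₁ N)) ⟩
      error
        ≤⟨ *-monoʳ-≤ (κ q) (window-error≤ d′ r₁ N _ _ (midLevels-bound r₁) (midLevels-bound (r₁ + N))) ⟩
      κ q * (12 * (d * (1 + ⌊log₂ (N / d) ⌋) + (r₁ + d))) ≡⟨ *-assoc (κ q) 12 _ ⟨
      κ q * 12 * (d * (1 + ⌊log₂ (N / d) ⌋) + (r₁ + d))   ∎
      where
      open ≤-Reasoning
      error : ℕ
      error = κ q * (2 * d + d * midLevels r₁ + (2 * d + d * midLevels (r₁ + N)))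

gap : ∀ {r₁ r₂} → r₁ < r₂ → Σ[ d′ ∈ ℕ ] r₂ ≡ r₁ + suc d′
gap {r₁} r₁<r₂ with m≤n⇒∃[o]m+o≡n r₁<r₂
... | d′ , r₁+1+d′≡r₂ = d′ , trans (sym r₁+1+d′≡r₂) (sym (+-suc r₁ d′))

errTerm-≡ : ∀ N {r₁ r₂ d′} (r₁<r₂ : r₁ < r₂) → r₂ ≡ r₁ + suc d′ →
            errTerm N r₁ r₂ r₁<r₂ ≡ suc d′ * (1 + ⌊log₂ (N / suc d′) ⌋) + r₂
errTerm-≡ N {r₁} {r₂} {d′} r₁<r₂ r₂≡ rewrite trans (cong (_∸ r₁) r₂≡) (m+n∸m≡n r₁ (suc d′)) = refl

theorem4 : (p k : ℕ) .{{_ : NonZero p}} → Prime p → 1 ≤ k →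
    ∃[ C ] ((M : Fin (p ^ k) → Fin (p ^ k) → G p k) → IsDifferenceMatrix M →
      (a : ℕ → G p k) → IsRudinShapiro p k M a →
      (r₁ r₂ : ℕ) → (r₁<r₂ : r₁ < r₂) → (N : ℕ) →
      ∣ + (p ^ k * Sδ a r₁ r₂ N) - + (N * (p ^ k ∸ 1)) ∣ ≤ C * errTerm N r₁ r₂ r₁<r₂)
theorem4 p k p-prime 1≤k = κ (p ^ k) * 12 , λ M isDM a isRS r₁ r₂ r₁<r₂ N →
  let d′ , r₂≡r₁+d = gap r₁<r₂
      open RudinShapiro M a isRS
      open Gap isDM q≥2 d′
  in ≤-trans (discrepancy r₁ r₂ N r₂≡r₁+d) (≤-reflexive (cong (κ q * 12 *_) (sym (errTerm-≡ N r₁<r₂ r₂≡r₁+d))))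
  where
  q≥2 : 2 ≤ p ^ k
  q≥2 = ≤-trans (nonTrivial⇒n>1 p {{prime⇒nonTrivial p-prime}}) (≤-trans (≤-reflexive (sym (*-identityʳ p))) (^-monoʳ-≤ p 1≤k))
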